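{- Let $\mathfrak{u}$ be a rooted unicellular blossoming map with the same number of leaves and buds. Then the closure of $\mathfrak{u}$ and the closure based on labels of $\mathfrak{u}$ coincide. Moreover, $\mathfrak{u}$ is well-rooted if and only if all labels of its canonical labeling are nonnegative.
   Context: A blossoming map is a map (cellular embedding of a connected graph in a compact orientable surface, given by counterclockwise cyclic orders at vertices) with extra dangling half-edges (stems) in the cyclic orders; a stem is a leaf if oriented towards its vertex, a bud otherwise. Rooted: one bud is marked (root bud); the root corner is the corner immediately preceding it counterclockwise. Unicellular: one face. The clockwise contour is the cyclic sequence of corners and stems met along the face boundary starting at the root corner, face on the right; it induces a cyclic order on stems. Closure: repeatedly take a bud $\beta$ whose next stem in the cyclic order is a leaf $\ell$ and merge them into an edge oriented from the vertex of $\beta$ to that of $\ell$ (a local closure), removing both from the cyclic order, until no stems remain; root the result at the corner that preceded the root bud. (This is independent of the order of local closures.) $\mathfrak{u}$ is well-rooted if no local closure of the closure matches a bud $\beta$ other than the root bud with a leaf $\ell$ such that the root bud is met when going in the cyclic order from $\beta$ to $\ell$ (equivalently, the local closure of the root bud can be performed last). Canonical labeling $\lambda$ of corners: root corner $0$; if $\kappa_2$ follows $\kappa_1$ in the contour then $\lambda(\kappa_2)=\lambda(\kappa_1)$ if they are separated by an edge traversal, $\lambda(\kappa_1)+1$ if separated by a bud, $\lambda(\kappa_1)-1$ if separated by a leaf. A stem between corners labelled $i-1$ and $i$ gets label $i$. Closure based on labels: each bud $\beta$ is merged (as an edge oriented from its vertex) with the first leaf $\ell(\beta)$ after it in the cyclic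 order having $\lambda(\ell(\beta))=\lambda(\beta)$; the result is rooted at the corner that preceded the root bud. -}

module Defs where

open import Data.Nat using (ℕ; zero; suc; _<_)
open import Data.Integer using (ℤ; +_; -[1+_]; _+_; _≤_)
open import Data.Fin using (Fin)
open import Data.Fin.Permutation using (Permutation′; _⟨$⟩ʳ_; _⟨$⟩ˡ_)
open import Data.Bool using (Bool; true; false)
open import Data.List using (List; []; _∷_; _++_; length; filterᵇ; upTo; allFin)
open import Data.Product using (_×_; _,_; ∃-syntax)
open import Data.Sum using (_⊎_)
open import Relation.Binary.PropositionalEquality using (_≡_; _≢_)
open import Relation.Binary.Construct.Closure.ReflexiveTransitive using (Star)
open import Relation.Nullary using (¬_)
open import Data.List.Membership.Propositional using (_∈_)

data HEKind : Set where
  edgeHalf bud leaf : HEKind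

isStemᵇ : HEKind → Bool
isStemᵇ edgeHalf = false
isStemᵇ bud      = true
isStemᵇ leaf     = true

isBudᵇ : HEKind → Bool
isBudᵇ bud = true
isBudᵇ _   = false

isLeafᵇ : HEKind → Bool
isLeafᵇ leaf = true
isLeafᵇ _    = false

-- A blossoming map as a combinatorial map on half-edges Fin n:
--  σ : counterclockwise rotation around vertices (vertices = σ-cycles),
--  α : involution pairing the two halves of each edge; stems are exactly
--      the fixed points of α,
--  connectivity: the group generated by σ and α acts transitively.
record BlossomingMap (n : ℕ) : Set where
  field
    σ        : Permutation′ n
    α        : Fin n → Fin n
    α-invol  : ∀ h → α (α h) ≡ h
    kind     : Fin n → HEKind
    edge-not-fixed : ∀ h → kind h ≡ edgeHalf → α h ≢ h
    stem-fixed     : ∀ h → kind h ≢ edgeHalf → α h ≡ h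
    connected : ∀ h h' →
      Star (λ a b → (b ≡ σ ⟨$⟩ʳ a) ⊎ ((b ≡ σ ⟨$⟩ˡ a) ⊎ (b ≡ α a))) h h'

-- Rooted: a marked bud (root bud).  The root corner is the corner
-- immediately preceding it counterclockwise.
record RootedBlossomingMap (n : ℕ) : Set where
  field
    map      : BlossomingMap n
    root     : Fin n
  open BlossomingMap map public
  field
    root-bud : kind root ≡ bud

module _ {n : ℕ} (u : RootedBlossomingMap n) where
  open RootedBlossomingMap u

  -- Corners are indexed by half-edges: corner c_h lies between σ⁻¹ h and h.
  -- Walking with the face on the right, from corner c_h one traverses h
  -- (an edge traversal, or passing a stem) and reaches corner c_{σ(α h)}.
  faceStep : Fin n → Fin n
  faceStep h = σ ⟨$⟩ʳ (α h)

  faceIter : ℕ → Fin n → Fin n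
  faceIter zero    h = h
  faceIter (suc i) h = faceIter i (faceStep h)

  -- contour i : the half-edge traversed at step i of the clockwise contour
  -- starting at the root corner (so step i goes from corner c_{contour i}
  -- to corner c_{contour (suc i)}); contour 0 = root bud.
  contour : ℕ → Fin n
  contour i = faceIter i root

  Unicellular : Set
  Unicellular = ∀ h → ∃[ i ] (contour i ≡ h)

  numBuds : ℕ
  numBuds = length (filterᵇ (λ h → isBudᵇ (kind h)) (allFin n))

  numLeaves : ℕ
  numLeaves = length (filterᵇ (λ h → isLeafᵇ (kind h)) (allFin n))

  step : HEKind → ℤ
  step edgeHalf = + 0
  step bud      = + 1
  step leaf     = -[1+ 0 ]

  cornerLabel : ℕ → ℤ
  cornerLabel zero    = + 0
  cornerLabel (suc i) = cornerLabel i + step (kind (contour i))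

  -- Label of the stem at contour position i (between corners labelled i-1 and i
  -- it gets label i).
  stemLabel : ℕ → ℤ
  stemLabel i with kind (contour i)
  ... | bud      = cornerLabel (suc i)
  ... | leaf     = cornerLabel i
  ... | edgeHalf = cornerLabel i

  stemsInOrder : List ℕ
  stemsInOrder = filterᵇ (λ i → isStemᵇ (kind (contour i))) (upTo n)

  -- Closure: a complete sequence of local closures on the cyclic list of
  -- remaining stems; recorded as the list of (bud , leaf) pairs merged into
  -- edges oriented from the bud's vertex to the leaf's vertex.
  data ClosureSeq : List ℕ → List (ℕ × ℕ) → Set where
    done : ClosureSeq [] []
    close-mid : ∀ xs ys b l ps →
      kind (contour b) ≡ bud → kind (contour l) ≡ leaf →
      ClosureSeq (xs ++ ys) ps →
      ClosureSeq (xs ++ (b ∷ l ∷ ys)) ((b , l) ∷ ps)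
    close-wrap : ∀ l xs b ps →
      kind (contour b) ≡ bud → kind (contour l) ≡ leaf →
      ClosureSeq xs ps →
      ClosureSeq (l ∷ (xs ++ (b ∷ []))) ((b , l) ∷ ps)

  -- k is met strictly between i and j when going cyclically from i to j
  -- (positions in 0 .. n-1, i ≢ j).
  CycBetween : ℕ → ℕ → ℕ → Set
  CycBetween i k j = (i < j × (i < k × k < j)) ⊎ (j < i × (i < k ⊎ k < j))

  LabelMatch : ℕ → ℕ → Set
  LabelMatch b l =
    b < n × l < n × kind (contour b) ≡ bud × kind (contour l) ≡ leaf ×
    stemLabel l ≡ stemLabel b ×
    (∀ k → k < n → kind (contour k) ≡ leaf → stemLabel k ≡ stemLabel b →
       ¬ CycBetween b k l)

  WellRooted : Set
  WellRooted = ∀ ps → ClosureSeq stemsInOrder ps → ∀ b l → (b , l) ∈ ps →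
    b ≢ 0 → ¬ CycBetween b 0 l

  AllLabelsNonneg : Set
  AllLabelsNonneg = ∀ i → i < n → + 0 ≤ cornerLabel i

-- Along the contour, corner labels go up by one after a bud, down by one after a leaf, and are
-- unchanged across an edge; as buds and leaves are equinumerous, they are n-periodic. The closure
-- keeps the invariant that consecutive remaining stems are separated by excursions, stretches of
-- the contour that return to their starting label without going below it: initially only edges
-- separate stems, and closing a bud followed by a leaf fuses three excursions into one. So every
-- closed bud-leaf pair spans an excursion starting right after the bud, which is exactly the
-- label-based matching. Closures exist because a cyclic sequence of stems without a bud followed
-- by a leaf consists of buds only or of leaves only, whose labels could not return after one turn.
-- A pair closed around the root spans corner n, of label 0, so its bud has a negative label; and a
-- first negative label follows a leaf at level 0, whose bud has to close around the root.
module Submission where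

open import Defs
open import Data.Nat using (ℕ)
open import Data.Product using (_×_; _,_; ∃-syntax)
open import Data.List.Membership.Propositional using (_∈_)
open import Function.Bundles using (_⇔_)
open import Relation.Binary.PropositionalEquality using (_≡_)

open import Data.Bool using (Bool; T; T?; true; false)
open import Data.Empty using (⊥-elim)
open import Data.Fin using (Fin; toℕ; fromℕ<)
open import Data.Fin.Permutation using (_⟨$⟩ˡ_; inverseˡ)
open import Data.Fin.Properties using (toℕ-fromℕ<; pigeonhole; injective⇒≤; toℕ<n; nonZeroIndex)
open import Data.Integer as ℤ using (ℤ; +_; -[1+_]; _⊖_)
import Data.Integer.Properties as ℤ
open import Data.List
  using (List; []; _∷_; _++_; _∷ʳ_; [_]; length; filterᵇ; map; upTo; applyUpTo; allFin; initLast; _∷ʳ′_)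
open import Data.List.Properties
  using (filter-++; filter-accept; length-++; map-++; map-∘; map-upTo; upTo-∷ʳ; applyUpTo-∷ʳ; ++-identityʳ)
open import Data.List.Membership.Propositional.Properties
  using (∈-filter⁺; ∈-filter⁻; ∈-upTo⁺; ∈-upTo⁻; ∈-allFin; ∈-applyUpTo⁺)
open import Data.List.Membership.Propositional.Properties.WithK using (unique∧set⇒bag)
open import Data.List.Relation.Binary.BagAndSetEquality using (∼bag⇒↭)
open import Data.List.Relation.Binary.Permutation.Propositional
  using (_↭_; ↭-sym; ↭-trans; ↭-prep; ↭-swap; ↭-refl)
open import Data.List.Relation.Binary.Permutation.Propositional.Properties
  using (shift; ∷↭∷ʳ; ∈-resp-↭; All-resp-↭; map⁺; filter-↭; ↭-length)
open import Data.List.Relation.Unary.All as All using (All; []; _∷_)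
open import Data.List.Relation.Unary.All.Properties using (∷ʳ⁻)
open import Data.List.Relation.Unary.Any using (here; there)
open import Data.List.Relation.Unary.Unique.Propositional.Properties using (applyUpTo⁺₁; allFin⁺)
open import Data.Nat.Base using (NonZero; pred; suc; zero; _+_; _*_; _∸_; _≤_; _<_; s≤s; z≤n)
open import Data.Nat.DivMod using (_%_; _/_; m%n<n; m≡m%n+[m/n]*n)
open import Data.Nat.Induction using (<-wellFounded; <-rec)
open import Data.Nat.Properties
import Data.Product as Product
open import Data.Product using (proj₁; proj₂; map₁; map₂)
open import Data.Sum as Sum using (_⊎_; inj₁; inj₂)
open import Data.Unit using (⊤; tt)
open import Function using (_∘_)
open import Function.Bundles using (mk⇔)
open import Induction.WellFounded using (Acc; acc)
open import Relation.Binary.Definitions using (tri<; tri≈; tri>)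
open import Relation.Binary.PropositionalEquality
  using (_≢_; refl; sym; trans; cong; cong₂; subst; subst₂; module ≡-Reasoning)
open import Relation.Nullary using (¬_; yes; no)

i<i+1 : ∀ i → i ℤ.< i ℤ.+ + 1
i<i+1 i = subst (ℤ._< i ℤ.+ + 1) (ℤ.+-identityʳ i) (ℤ.+-monoʳ-< i (ℤ.+<+ (s≤s z≤n)))

i-1<i : ∀ i → i ℤ.+ -[1+ 0 ] ℤ.< i
i-1<i i = subst (i ℤ.+ -[1+ 0 ] ℤ.<_) (ℤ.+-identityʳ i) (ℤ.+-monoʳ-< i ℤ.-<+)

0≤i-1 : ∀ {i} → + 0 ℤ.≤ i → i ≢ + 0 → + 0 ℤ.≤ i ℤ.+ -[1+ 0 ]
0≤i-1 {+ zero}  _ i≢0 = ⊥-elim (i≢0 refl)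
0≤i-1 {+ suc i} _ _   = ℤ.+≤+ z≤n

bud≢leaf : bud ≢ leaf
bud≢leaf ()

isStemᵇ-sound : ∀ {k} → T (isStemᵇ k) → k ≡ bud ⊎ k ≡ leaf
isStemᵇ-sound {bud}  _ = inj₁ refl
isStemᵇ-sound {leaf} _ = inj₂ refl

isStemᵇ-complete : ∀ {k} → k ≡ bud ⊎ k ≡ leaf → T (isStemᵇ k)
isStemᵇ-complete (inj₁ refl) = tt
isStemᵇ-complete (inj₂ refl) = tt

numOf : (HEKind → Bool) → List HEKind → ℕ
numOf q = length ∘ filterᵇ q

numOf-++ : ∀ q ks ks′ → numOf q (ks ++ ks′) ≡ numOf q ks + numOf q ks′
numOf-++ q ks ks′ = trans (cong length (filter-++ _ ks ks′)) (length-++ (filterᵇ q ks))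

numOf-map : ∀ {A : Set} q (f : A → HEKind) xs → numOf q (map f xs) ≡ length (filterᵇ (q ∘ f) xs)
numOf-map q f []       = refl
numOf-map q f (x ∷ xs) with q (f x)
... | true  = cong suc (numOf-map q f xs)
... | false = numOf-map q f xs

module _ {A : Set} where

  adjacent-↭ : ∀ xs {b l : A} ys → xs ++ b ∷ l ∷ ys ↭ b ∷ l ∷ xs ++ ys
  adjacent-↭ xs {b} {l} ys = ↭-trans (shift b xs (l ∷ ys)) (↭-prep b (shift l xs ys))

  wrapped-↭ : ∀ (l : A) xs b → l ∷ xs ++ [ b ] ↭ b ∷ l ∷ xs
  wrapped-↭ l xs b = ↭-trans (↭-prep l (↭-sym (∷↭∷ʳ b xs))) (↭-swap l b ↭-refl)

  module _ (Bud Leaf : A → Set) where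

    data BudLeafView : List A → Set where
      adjacent  : ∀ xs b l ys → Bud b → Leaf l → BudLeafView (xs ++ b ∷ l ∷ ys)
      wrapped   : ∀ l xs b → Bud b → Leaf l → BudLeafView (l ∷ xs ++ [ b ])
      allBuds   : ∀ {zs} → All Bud zs → BudLeafView zs
      allLeaves : ∀ {zs} → All Leaf zs → BudLeafView zs

    leaf∷buds-view : ∀ {l zs} → Leaf l → All Bud zs → BudLeafView (l ∷ zs)
    leaf∷buds-view {zs = zs} ll bs with initLast zs
    ... | []      = allLeaves (ll ∷ [])
    ... | xs ∷ʳ′ b = wrapped _ xs b (proj₂ (∷ʳ⁻ bs)) ll

    budLeafView : ∀ {zs} → All (λ z → Bud z ⊎ Leaf z) zs → BudLeafView zs
    budLeafView [] = allBuds []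
    budLeafView (inj₁ bz ∷ ss) with budLeafView ss
    ... | adjacent xs b l ys bb ll = adjacent (_ ∷ xs) b l ys bb ll
    ... | wrapped l xs b _ ll      = adjacent [] _ l (xs ++ [ b ]) bz ll
    ... | allBuds bs               = allBuds (bz ∷ bs)
    ... | allLeaves []             = allBuds (bz ∷ [])
    ... | allLeaves (ll ∷ _)       = adjacent [] _ _ _ bz ll
    budLeafView (inj₂ lz ∷ ss) with budLeafView ss
    ... | adjacent xs b l ys bb ll = adjacent (_ ∷ xs) b l ys bb ll
    ... | wrapped l xs b bb _      = wrapped _ (l ∷ xs) b bb lz
    ... | allBuds bs               = leaf∷buds-view lz bs
    ... | allLeaves ls             = allLeaves (lz ∷ ls)

module _ {n : ℕ} (u : RootedBlossomingMap n) where
  open RootedBlossomingMap u hiding (map)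
  open ≡-Reasoning

  faceStep-injective : ∀ {h h′} → faceStep u h ≡ faceStep u h′ → h ≡ h′
  faceStep-injective {h} {h′} eq = begin
    h         ≡⟨ α-invol h ⟨
    α (α h)   ≡⟨ cong α α-eq ⟩
    α (α h′)  ≡⟨ α-invol h′ ⟩
    h′        ∎
    where
    α-eq : α h ≡ α h′
    α-eq = trans (sym (inverseˡ σ)) (trans (cong (σ ⟨$⟩ˡ_) eq) (inverseˡ σ))

  faceIter-+ : ∀ i j h → faceIter u (i + j) h ≡ faceIter u j (faceIter u i h)
  faceIter-+ zero    j h = refl
  faceIter-+ (suc i) j h = faceIter-+ i j (faceStep u h)

  faceIter-injective : ∀ i {h h′} → faceIter u i h ≡ faceIter u i h′ → h ≡ h′
  faceIter-injective zero    eq = eq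
  faceIter-injective (suc i) eq = faceStep-injective (faceIter-injective i eq)

  contour-periodic : ∀ d → contour u d ≡ root → ∀ i → contour u (d + i) ≡ contour u i
  contour-periodic d cd i = trans (faceIter-+ d i root) (cong (faceIter u i) cd)

  contour-returns-after-gap : ∀ {i j} → i ≤ j → contour u i ≡ contour u j → contour u (j ∸ i) ≡ root
  contour-returns-after-gap {i} {j} i≤j eq = sym (faceIter-injective i (begin
    faceIter u i root                 ≡⟨ eq ⟩
    contour u j                       ≡⟨ cong (contour u) (m∸n+n≡m i≤j) ⟨
    contour u (j ∸ i + i)             ≡⟨ faceIter-+ (j ∸ i) i root ⟩
    faceIter u i (contour u (j ∸ i))  ∎))

  contour-%-period : ∀ d .{{_ : NonZero d}} → contour u d ≡ root → ∀ i → contour u (i % d) ≡ contour u i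
  contour-%-period d cd i = begin
    contour u (i % d)              ≡⟨ multiples (i / d) ⟨
    contour u (i / d * d + i % d)  ≡⟨ cong (contour u) (trans (+-comm _ (i % d)) (sym (m≡m%n+[m/n]*n i d))) ⟩
    contour u i                    ∎
    where
    multiples : ∀ q → contour u (q * d + i % d) ≡ contour u (i % d)
    multiples zero    = refl
    multiples (suc q) = trans (cong (contour u) (+-assoc d (q * d) (i % d)))
                              (trans (contour-periodic d cd _) (multiples q))

  instance
    n-nonZero : NonZero n
    n-nonZero = nonZeroIndex root

  kindAt : ℕ → HEKind
  kindAt i = kind (contour u i)

  IsBud IsLeaf IsStem : ℕ → Set
  IsBud i  = kindAt i ≡ bud
  IsLeaf i = kindAt i ≡ leaf
  IsStem i = IsBud i ⊎ IsLeaf i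

  label : ℕ → ℤ
  label = cornerLabel u

  label-bud : ∀ {i} → IsBud i → label (suc i) ≡ label i ℤ.+ + 1
  label-bud {i} kb = cong (λ k → label i ℤ.+ step u k) kb

  label-leaf : ∀ {i} → IsLeaf i → label (suc i) ≡ label i ℤ.+ -[1+ 0 ]
  label-leaf {i} kl = cong (λ k → label i ℤ.+ step u k) kl

  label-edge : ∀ {i} → kindAt i ≡ edgeHalf → label (suc i) ≡ label i
  label-edge {i} ke = trans (cong (λ k → label i ℤ.+ step u k) ke) (ℤ.+-identityʳ (label i))

  label-bud-< : ∀ {i} → IsBud i → label i ℤ.< label (suc i)
  label-bud-< {i} kb = subst (label i ℤ.<_) (sym (label-bud {i} kb)) (i<i+1 (label i))

  stemLabel-bud : ∀ {i} → IsBud i → stemLabel u i ≡ label (suc i)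
  stemLabel-bud {i} kb with kindAt i in ki | kb
  ... | bud | _ = label-bud {i} ki

  stemLabel-leaf : ∀ {i} → IsLeaf i → stemLabel u i ≡ label i
  stemLabel-leaf {i} kl with kindAt i | kl
  ... | leaf | refl = refl

  bud≢leaf-position : ∀ {b l} → IsBud b → IsLeaf l → b ≢ l
  bud≢leaf-position kb kl refl = bud≢leaf (trans (sym kb) kl)

  leaf-not-root : ∀ {i} → IsLeaf i → 0 < i
  leaf-not-root {zero}  kl = ⊥-elim (bud≢leaf (trans (sym root-bud) kl))
  leaf-not-root {suc i} _  = s≤s z≤n

  ⊖-+-step : ∀ k B L → (B ⊖ L) ℤ.+ step u k ≡ (B + numOf isBudᵇ [ k ]) ⊖ (L + numOf isLeafᵇ [ k ])
  ⊖-+-step edgeHalf B L rewrite +-identityʳ B | +-identityʳ L = ℤ.+-identityʳ (B ⊖ L)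
  ⊖-+-step bud      B L rewrite +-identityʳ L = ℤ.distribˡ-⊖-+-pos 1 B L
  ⊖-+-step leaf     B L rewrite +-identityʳ B =
    trans (ℤ.distribˡ-⊖-+-neg 0 B L) (cong (B ⊖_) (trans (+-identityʳ (suc L)) (+-comm 1 L)))

  label-count : ∀ i → label i ≡ numOf isBudᵇ (map kindAt (upTo i)) ⊖ numOf isLeafᵇ (map kindAt (upTo i))
  label-count zero    = refl
  label-count (suc i) = begin
    label i ℤ.+ step u (kindAt i)
      ≡⟨ cong (ℤ._+ step u (kindAt i)) (label-count i) ⟩
    (numOf isBudᵇ ks ⊖ numOf isLeafᵇ ks) ℤ.+ step u (kindAt i)
      ≡⟨ ⊖-+-step (kindAt i) (numOf isBudᵇ ks) (numOf isLeafᵇ ks) ⟩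
    (numOf isBudᵇ ks + numOf isBudᵇ [ kindAt i ]) ⊖ (numOf isLeafᵇ ks + numOf isLeafᵇ [ kindAt i ])
      ≡⟨ cong₂ _⊖_ (numOf-++ isBudᵇ ks [ kindAt i ]) (numOf-++ isLeafᵇ ks [ kindAt i ]) ⟨
    numOf isBudᵇ (ks ∷ʳ kindAt i) ⊖ numOf isLeafᵇ (ks ∷ʳ kindAt i)
      ≡⟨ cong (λ ks′ → numOf isBudᵇ ks′ ⊖ numOf isLeafᵇ ks′)
              (trans (cong (map kindAt) (sym (upTo-∷ʳ i))) (map-++ kindAt (upTo i) [ i ])) ⟨
    numOf isBudᵇ (map kindAt (upTo (suc i))) ⊖ numOf isLeafᵇ (map kindAt (upTo (suc i)))  ∎
    where
    ks : List HEKind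
    ks = map kindAt (upTo i)

  stemsOf : List ℕ → List ℕ
  stemsOf = filterᵇ (isStemᵇ ∘ kindAt)

  ∈-stems⁻ : ∀ {i} → i ∈ stemsInOrder u → i < n × IsStem i
  ∈-stems⁻ i∈ = Product.map ∈-upTo⁻ isStemᵇ-sound (∈-filter⁻ (T? ∘ isStemᵇ ∘ kindAt) i∈)

  ∈-stems⁺ : ∀ {i} → i < n → IsStem i → i ∈ stemsInOrder u
  ∈-stems⁺ i<n ki = ∈-filter⁺ (T? ∘ isStemᵇ ∘ kindAt) (∈-upTo⁺ i<n) (isStemᵇ-complete ki)

  record Excursion (x y : ℕ) : Set where
    field
      start≤end : x ≤ y
      returns   : label y ≡ label x
      above     : ∀ {k} → x ≤ k → k ≤ y → label x ℤ.≤ label k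
  open Excursion

  excursion-refl : ∀ x → Excursion x x
  excursion-refl x = record
    { start≤end = ≤-refl
    ; returns   = refl
    ; above     = λ x≤k k≤x → ℤ.≤-reflexive (cong label (≤-antisym x≤k k≤x))
    }

  excursion-edge : ∀ {x y} → Excursion x y → kindAt y ≡ edgeHalf → Excursion x (suc y)
  excursion-edge {x} {y} e ke = record
    { start≤end = m≤n⇒m≤1+n (start≤end e)
    ; returns   = trans (label-edge {y} ke) (returns e)
    ; above     = above′
    }
    where
    above′ : ∀ {k} → x ≤ k → k ≤ suc y → label x ℤ.≤ label k
    above′ x≤k k≤1+y with m≤n⇒m<n∨m≡n k≤1+y
    ... | inj₁ k<1+y = above e x≤k (≤-pred k<1+y)
    ... | inj₂ refl  = ℤ.≤-reflexive (sym (trans (label-edge {y} ke) (returns e)))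

  excursion-rises : ∀ {b y} → IsBud b → Excursion (suc b) y → label b ℤ.< label y
  excursion-rises {b} kb e = subst (_ ℤ.<_) (sym (returns e)) (label-bud-< {b} kb)

  excursion-falls : ∀ {l y} → IsLeaf l → Excursion (suc l) y → label y ℤ.< label l
  excursion-falls {l} kl e = subst (ℤ._< label l) (sym (trans (returns e) (label-leaf {l} kl))) (i-1<i (label l))

  excursion-pair-level : ∀ {b l} → IsBud b → Excursion (suc b) l → IsLeaf l → label (suc l) ≡ label b
  excursion-pair-level {b} {l} kb e kl = begin
    label (suc l)                   ≡⟨ label-leaf {l} kl ⟩
    label l ℤ.+ -[1+ 0 ]            ≡⟨ cong (ℤ._+ -[1+ 0 ]) (trans (returns e) (label-bud {b} kb)) ⟩
    label b ℤ.+ + 1 ℤ.+ -[1+ 0 ]    ≡⟨ ℤ.+-assoc (label b) (+ 1) -[1+ 0 ] ⟩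
    label b ℤ.+ + 0                 ≡⟨ ℤ.+-identityʳ (label b) ⟩
    label b                         ∎

  excursion-close : ∀ {x b l z} → Excursion x b → IsBud b → Excursion (suc b) l → IsLeaf l →
                    Excursion (suc l) z → Excursion x z
  excursion-close {x} {b} {l} {z} e₁ kb e₂ kl e₃ = record
    { start≤end = ≤-trans (start≤end e₁) (≤-trans (n≤1+n b)
                    (≤-trans (start≤end e₂) (≤-trans (n≤1+n l) (start≤end e₃))))
    ; returns   = trans (returns e₃) (trans level (returns e₁))
    ; above     = above′
    }
    where
    level : label (suc l) ≡ label b
    level = excursion-pair-level kb e₂ kl
    above′ : ∀ {k} → x ≤ k → k ≤ z → label x ℤ.≤ label k
    above′ {k} x≤k k≤z with k ≤? b | k ≤? l
    ... | yes k≤b | _       = above e₁ x≤k k≤b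
    ... | no k≰b  | yes k≤l = subst (ℤ._≤ label k) (returns e₁)
                                (ℤ.<⇒≤ (ℤ.<-≤-trans (label-bud-< {b} kb) (above e₂ (≰⇒> k≰b) k≤l)))
    ... | no _    | no k≰l  = subst (ℤ._≤ label k) (trans level (returns e₁)) (above e₃ (≰⇒> k≰l) k≤z)

  excursion-no-base-leaf : ∀ {x y k} → Excursion x y → x ≤ k → k < y → IsLeaf k → label k ≢ label x
  excursion-no-base-leaf {x} {k = k} e x≤k k<y kl k-at-base =
    ℤ.<⇒≱ (subst (ℤ._< label x) (sym (trans (label-leaf {k} kl) (cong (ℤ._+ -[1+ 0 ]) k-at-base)))
                 (i-1<i (label x)))
          (above e (≤-trans x≤k (n≤1+n k)) k<y)

  Chain : ℕ → List ℕ → ℕ → Set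
  Chain a []       z = Excursion (suc a) z
  Chain a (x ∷ xs) z = Excursion (suc a) x × Chain x xs z

  chain-split : ∀ xs {a m ys z} → Chain a (xs ++ m ∷ ys) z → Chain a xs m × Chain m ys z
  chain-split []       (e , ch) = e , ch
  chain-split (x ∷ xs) (e , ch) = map₁ (e ,_) (chain-split xs ch)

  chain-join : ∀ xs {a m ys z} → Chain a xs m → Chain m ys z → Chain a (xs ++ m ∷ ys) z
  chain-join []       e        ch = e , ch
  chain-join (x ∷ xs) (e , ch) ch′ = e , chain-join xs ch ch′

  chain-mapLast : ∀ {z z′} → (∀ {p} → Excursion (suc p) z → Excursion (suc p) z′) →
                  ∀ {a} xs → Chain a xs z → Chain a xs z′
  chain-mapLast f []       e        = f e
  chain-mapLast f (x ∷ xs) (e , ch) = e , chain-mapLast f xs ch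

  chain-< : ∀ {a} xs {z} → Chain a xs z → a < z
  chain-< []       e        = start≤end e
  chain-< (x ∷ xs) (e , ch) = <-trans (start≤end e) (chain-< xs ch)

  chain-close : ∀ {b l z} → IsBud b → Excursion (suc b) l → IsLeaf l → Excursion (suc l) z →
                ∀ {a} xs → Chain a xs b → Chain a xs z
  chain-close kb e kl e′ = chain-mapLast (λ e₀ → excursion-close e₀ kb e kl e′)

  chain-remove : ∀ {b l} → IsBud b → IsLeaf l →
                 ∀ {a} xs {ys z} → Chain a (xs ++ b ∷ l ∷ ys) z → Chain a (xs ++ ys) z
  chain-remove kb kl xs {[]} ch with chain-split xs ch
  ... | ch′ , e , e′ = subst (λ zs → Chain _ zs _) (sym (++-identityʳ xs)) (chain-close kb e kl e′ xs ch′)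
  chain-remove kb kl xs {y ∷ ys} ch with chain-split xs ch
  ... | ch′ , e , e′ , ch″ = chain-join xs (chain-close kb e kl e′ xs ch′) ch″

  chain-buds-rise : ∀ {a} xs {z} → All IsBud (a ∷ xs) → Chain a xs z → label a ℤ.< label z
  chain-buds-rise []       (ka ∷ _)   e        = excursion-rises ka e
  chain-buds-rise (x ∷ xs) (ka ∷ kxs) (e , ch) = ℤ.<-trans (excursion-rises ka e) (chain-buds-rise xs kxs ch)

  chain-leaves-fall : ∀ {a} xs {z} → All IsLeaf (a ∷ xs) → Chain a xs z → label z ℤ.< label a
  chain-leaves-fall []       (ka ∷ _)   e        = excursion-falls ka e
  chain-leaves-fall (x ∷ xs) (ka ∷ kxs) (e , ch) = ℤ.<-trans (chain-leaves-fall xs kxs ch) (excursion-falls ka e)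

  -- The last stem is followed by the first one, one turn later along the contour.
  CyclicChain : List ℕ → Set
  CyclicChain []       = ⊤
  CyclicChain (x ∷ xs) = Chain x xs (n + x)

  cyclicChain-adjacent : ∀ xs {b l ys} → CyclicChain (xs ++ b ∷ l ∷ ys) → Excursion (suc b) l
  cyclicChain-adjacent []       (e , _) = e
  cyclicChain-adjacent (x ∷ xs) ch      = proj₁ (proj₂ (chain-split xs ch))

  cyclicChain-wrapped : ∀ {l} xs {b} → CyclicChain (l ∷ xs ++ [ b ]) → l < b × Excursion (suc b) (n + l)
  cyclicChain-wrapped xs ch = map₁ (chain-< xs) (chain-split xs ch)

  chain-stems : ∀ m → Chain 0 (stemsOf (applyUpTo suc m)) (suc m)
  chain-stems zero    = excursion-refl 1
  chain-stems (suc m) = subst (λ zs → Chain 0 zs (2 + m)) stems-∷ʳ (extend (kindAt (suc m)) refl)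
    where
    stems-∷ʳ : stemsOf (applyUpTo suc m) ++ stemsOf [ suc m ] ≡ stemsOf (applyUpTo suc (suc m))
    stems-∷ʳ = trans (sym (filter-++ _ (applyUpTo suc m) [ suc m ])) (cong stemsOf (applyUpTo-∷ʳ suc m))
    extend : ∀ k → kindAt (suc m) ≡ k → Chain 0 (stemsOf (applyUpTo suc m) ++ stemsOf [ suc m ]) (2 + m)
    extend edgeHalf ke rewrite ke | ++-identityʳ (stemsOf (applyUpTo suc m)) =
      chain-mapLast (λ e → excursion-edge e ke) _ (chain-stems m)
    extend bud      ke rewrite ke = chain-join (stemsOf (applyUpTo suc m)) (chain-stems m) (excursion-refl (2 + m))
    extend leaf     ke rewrite ke = chain-join (stemsOf (applyUpTo suc m)) (chain-stems m) (excursion-refl (2 + m))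

  stems-cyclicChain : CyclicChain (stemsInOrder u)
  stems-cyclicChain = subst CyclicChain (sym stems≡)
    (subst (Chain 0 _) (trans (suc-pred n) (sym (+-identityʳ n))) (chain-stems (pred n)))
    where
    stems≡ : stemsInOrder u ≡ 0 ∷ stemsOf (applyUpTo suc (pred n))
    stems≡ = trans (cong (stemsOf ∘ upTo) (sym (suc-pred n)))
                   (filter-accept (T? ∘ isStemᵇ ∘ kindAt) (isStemᵇ-complete (inj₁ root-bud)))

  closureSeq-uncons : ∀ {zs b l ps} → ClosureSeq u zs ((b , l) ∷ ps) →
    IsBud b × IsLeaf l × ∃[ zs′ ] (zs ↭ b ∷ l ∷ zs′ × ClosureSeq u zs′ ps)
  closureSeq-uncons (close-mid xs ys b l ps kb kl cs) = kb , kl , xs ++ ys , adjacent-↭ xs ys , cs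
  closureSeq-uncons (close-wrap l xs b ps kb kl cs)  = kb , kl , xs , wrapped-↭ l xs b , cs

  closure-kinds : ∀ {zs} ps → ClosureSeq u zs ps → ∀ {b l} → (b , l) ∈ ps → IsBud b × IsLeaf l
  closure-kinds (_ ∷ ps) cs bl∈ with closureSeq-uncons cs | bl∈
  ... | kb , kl , _ | here refl = kb , kl
  ... | _ , _ , _ , _ , cs′ | there bl∈′ = closure-kinds ps cs′ bl∈′

  closure-⊆ : ∀ {zs} ps → ClosureSeq u zs ps → ∀ {b l} → (b , l) ∈ ps → b ∈ zs × l ∈ zs
  closure-⊆ {zs} (_ ∷ ps) cs bl∈ with closureSeq-uncons cs | bl∈
  ... | _ , _ , _ , p , _    | here refl  = ∈-resp-↭ (↭-sym p) (here refl) , ∈-resp-↭ (↭-sym p) (there (here refl))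
  ... | _ , _ , zs′ , p , cs′ | there bl∈′ = Product.map restore restore (closure-⊆ ps cs′ bl∈′)
    where
    restore : ∀ {x} → x ∈ zs′ → x ∈ zs
    restore = ∈-resp-↭ (↭-sym p) ∘ there ∘ there

  closure-covers : ∀ {zs} ps → ClosureSeq u zs ps →
                   ∀ {x} → x ∈ zs → ∃[ y ] ((x , y) ∈ ps ⊎ (y , x) ∈ ps)
  closure-covers [] done ()
  closure-covers (_ ∷ ps) cs x∈ with closureSeq-uncons cs
  ... | _ , _ , _ , p , cs′ with ∈-resp-↭ p x∈
  ...   | here refl         = _ , inj₁ (here refl)
  ...   | there (here refl) = _ , inj₂ (here refl)
  ...   | there (there x∈′) = map₂ (Sum.map there there) (closure-covers ps cs′ x∈′)

  closure-bud-partner : ∀ {zs ps b} → ClosureSeq u zs ps → b ∈ zs → IsBud b → ∃[ l ] (b , l) ∈ ps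
  closure-bud-partner cs b∈ kb with closure-covers _ cs b∈
  ... | l , inj₁ bl∈ = l , bl∈
  ... | _ , inj₂ yb∈ = ⊥-elim (bud≢leaf (trans (sym kb) (proj₂ (closure-kinds _ cs yb∈))))

  closure-leaf-partner : ∀ {zs ps l} → ClosureSeq u zs ps → l ∈ zs → IsLeaf l → ∃[ b ] (b , l) ∈ ps
  closure-leaf-partner cs l∈ kl with closure-covers _ cs l∈
  ... | b , inj₂ bl∈ = b , bl∈
  ... | _ , inj₁ ly∈ = ⊥-elim (bud≢leaf (trans (sym (proj₁ (closure-kinds _ cs ly∈))) kl))

  cycBetween-either : ∀ {i j k} → i ≢ j → i ≢ k → j ≢ k → CycBetween u i j k ⊎ CycBetween u i k j
  cycBetween-either {i} {j} {k} i≢j i≢k j≢k with <-cmp i j | <-cmp i k | <-cmp j k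
  ... | tri≈ _ i≡j _ | _ | _ = ⊥-elim (i≢j i≡j)
  ... | _ | tri≈ _ i≡k _ | _ = ⊥-elim (i≢k i≡k)
  ... | _ | _ | tri≈ _ j≡k _ = ⊥-elim (j≢k j≡k)
  ... | tri< i<j _ _ | tri< i<k _ _ | tri< j<k _ _ = inj₁ (inj₁ (i<k , i<j , j<k))
  ... | tri< i<j _ _ | tri< i<k _ _ | tri> _ _ k<j = inj₂ (inj₁ (i<j , i<k , k<j))
  ... | tri< i<j _ _ | tri> _ _ k<i | _            = inj₁ (inj₂ (k<i , inj₁ i<j))
  ... | tri> _ _ j<i | tri< i<k _ _ | _            = inj₂ (inj₂ (j<i , inj₁ i<k))
  ... | tri> _ _ j<i | tri> _ _ k<i | tri< j<k _ _ = inj₁ (inj₂ (k<i , inj₂ j<k))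
  ... | tri> _ _ j<i | tri> _ _ k<i | tri> _ _ k<j = inj₂ (inj₂ (j<i , inj₂ k<j))

  labelMatch-unique : ∀ {b l l′} → LabelMatch u b l → LabelMatch u b l′ → l ≡ l′
  labelMatch-unique {b} {l} {l′} (_ , l<n , kb , kl , eq , first) (_ , l′<n , _ , kl′ , eq′ , first′)
    with l ≟ l′
  ... | yes l≡l′ = l≡l′
  ... | no l≢l′
    with cycBetween-either (bud≢leaf-position {b} kb kl) (bud≢leaf-position {b} kb kl′) l≢l′
  ...   | inj₁ l-first  = ⊥-elim (first′ l l<n kl eq l-first)
  ...   | inj₂ l′-first = ⊥-elim (first l′ l′<n kl′ eq′ l′-first)

  -- The excursion spanned by closing b with l, read on the next turn of the contour when l < b.
  Arc : ℕ → ℕ → Set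
  Arc b l = Excursion (suc b) l ⊎ (l < b × Excursion (suc b) (n + l))

  module _ (unicellular : Unicellular u) where

    period-≥ : ∀ {d} → 0 < d → contour u d ≡ root → n ≤ d
    period-≥ {suc d} _ cd = injective⇒≤ index-injective
      where
      index : Fin n → Fin (suc d)
      index h = fromℕ< (m%n<n (proj₁ (unicellular h)) (suc d))
      contour-index : ∀ h → contour u (toℕ (index h)) ≡ h
      contour-index h = trans (cong (contour u) (toℕ-fromℕ< (m%n<n i (suc d))))
                              (trans (contour-%-period (suc d) cd i) (proj₂ (unicellular h)))
        where
        i : ℕ
        i = proj₁ (unicellular h)
      index-injective : ∀ {h h′} → index h ≡ index h′ → h ≡ h′
      index-injective {h} {h′} eq =
        trans (sym (contour-index h)) (trans (cong (contour u ∘ toℕ) eq) (contour-index h′))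

    contour-returns : contour u n ≡ root
    contour-returns with pigeonhole (n<1+n n) (contour u ∘ toℕ)
    ... | i , j , i<j , eq = subst (λ d → contour u d ≡ root) gap≡n returns-after-gap
      where
      returns-after-gap : contour u (toℕ j ∸ toℕ i) ≡ root
      returns-after-gap = contour-returns-after-gap (<⇒≤ i<j) eq
      gap≡n : toℕ j ∸ toℕ i ≡ n
      gap≡n = ≤-antisym (≤-trans (m∸n≤m (toℕ j) (toℕ i)) (≤-pred (toℕ<n j)))
                        (period-≥ (m<n⇒0<n∸m i<j) returns-after-gap)

    contour-injective : ∀ {i j} → i < j → j < n → contour u i ≢ contour u j
    contour-injective {i} {j} i<j j<n eq =
      <⇒≱ (≤-<-trans (m∸n≤m j i) j<n)
          (period-≥ (m<n⇒0<n∸m i<j) (contour-returns-after-gap (<⇒≤ i<j) eq))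

    contour-↭ : map (contour u) (upTo n) ↭ allFin n
    contour-↭ = subst (_↭ allFin n) (sym (map-upTo (contour u) n))
      (∼bag⇒↭ (unique∧set⇒bag (applyUpTo⁺₁ (contour u) n contour-injective) (allFin⁺ n)
        (λ {h} → mk⇔ (λ _ → ∈-allFin h) (λ _ → covered h))))
      where
      covered : ∀ h → h ∈ applyUpTo (contour u) n
      covered h with unicellular h
      ... | i , ci≡h = subst (_∈ applyUpTo (contour u) n) (trans (contour-%-period n contour-returns i) ci≡h)
                             (∈-applyUpTo⁺ (contour u) (m%n<n i n))

    numOf-contour : ∀ q → numOf q (map kindAt (upTo n)) ≡ length (filterᵇ (q ∘ kind) (allFin n))
    numOf-contour q = begin
      numOf q (map kindAt (upTo n))                  ≡⟨ cong (numOf q) (map-∘ (upTo n)) ⟩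
      numOf q (map kind (map (contour u) (upTo n)))  ≡⟨ ↭-length (filter-↭ _ (map⁺ kind contour-↭)) ⟩
      numOf q (map kind (allFin n))                  ≡⟨ numOf-map q kind (allFin n) ⟩
      length (filterᵇ (q ∘ kind) (allFin n))         ∎

    module Closure (balanced : numLeaves u ≡ numBuds u) where

      label-returns : label n ≡ + 0
      label-returns = begin
        label n                      ≡⟨ label-count n ⟩
        numOf isBudᵇ ks ⊖ numOf isLeafᵇ ks
                                     ≡⟨ cong₂ _⊖_ (numOf-contour isBudᵇ) (numOf-contour isLeafᵇ) ⟩
        numBuds u ⊖ numLeaves u      ≡⟨ cong (numBuds u ⊖_) balanced ⟩
        numBuds u ⊖ numBuds u        ≡⟨ ℤ.n⊖n≡0 (numBuds u) ⟩
        + 0                          ∎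
        where
        ks : List HEKind
        ks = map kindAt (upTo n)

      kindAt-periodic : ∀ i → kindAt (n + i) ≡ kindAt i
      kindAt-periodic i = cong kind (contour-periodic n contour-returns i)

      label-periodic : ∀ i → label (n + i) ≡ label i
      label-periodic zero    = trans (cong label (+-identityʳ n)) label-returns
      label-periodic (suc i) = begin
        label (n + suc i)
          ≡⟨ cong label (+-suc n i) ⟩
        label (n + i) ℤ.+ step u (kindAt (n + i))
          ≡⟨ cong₂ ℤ._+_ (label-periodic i) (cong (step u) (kindAt-periodic i)) ⟩
        label i ℤ.+ step u (kindAt i)
          ∎

      excursion-shift : ∀ {x y} → Excursion x y → Excursion (n + x) (n + y)
      excursion-shift {x} {y} e = record
        { start≤end = +-monoʳ-≤ n (start≤end e)
        ; returns   = trans (label-periodic y) (trans (returns e) (sym (label-periodic x)))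
        ; above     = above′
        }
        where
        above′ : ∀ {k} → n + x ≤ k → k ≤ n + y → label (n + x) ℤ.≤ label k
        above′ {k} lo hi =
          subst₂ ℤ._≤_ (sym (label-periodic x)) (trans (sym (label-periodic (k ∸ n))) (cong label k≡))
          (above e (+-cancelˡ-≤ n x (k ∸ n) (subst (n + x ≤_) (sym k≡) lo))
                   (+-cancelˡ-≤ n (k ∸ n) y (subst (_≤ n + y) (sym k≡) hi)))
          where
          k≡ : n + (k ∸ n) ≡ k
          k≡ = m+[n∸m]≡n (≤-trans (m≤m+n n x) lo)

      excursion-shift-suc : ∀ {x y} → Excursion (suc x) y → Excursion (suc (n + x)) (n + y)
      excursion-shift-suc {x} {y} e = subst (λ s → Excursion s (n + y)) (+-suc n x) (excursion-shift e)

      cyclicChain-close-adjacent : ∀ {b l} → IsBud b → IsLeaf l → ∀ xs {ys} →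
                                   CyclicChain (xs ++ b ∷ l ∷ ys) → CyclicChain (xs ++ ys)
      cyclicChain-close-adjacent kb kl (x ∷ xs)     ch           = chain-remove kb kl xs ch
      cyclicChain-close-adjacent kb kl [] {[]}     _            = tt
      cyclicChain-close-adjacent kb kl [] {y ∷ ys} (e , e′ , ch) =
        chain-close (trans (kindAt-periodic _) kb) (excursion-shift-suc e) (trans (kindAt-periodic _) kl)
                    (excursion-shift-suc e′) ys ch

      cyclicChain-close-wrapped : ∀ {b l} → IsBud b → IsLeaf l →
                                  ∀ xs → CyclicChain (l ∷ xs ++ [ b ]) → CyclicChain xs
      cyclicChain-close-wrapped kb kl []       _        = tt
      cyclicChain-close-wrapped kb kl (x ∷ xs) (e , ch) with chain-split xs ch
      ... | ch′ , e′ = chain-close kb e′ (trans (kindAt-periodic _) kl) (excursion-shift-suc e) xs ch′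

      closure-exists : ∀ {zs} → All IsStem zs → CyclicChain zs → ∃[ ps ] ClosureSeq u zs ps
      closure-exists {zs} stems ch = go stems ch (<-wellFounded (length zs))
        where
        drop-pair : ∀ {zs b l zs′} → zs ↭ b ∷ l ∷ zs′ → All IsStem zs → All IsStem zs′
        drop-pair p = All.tail ∘ All.tail ∘ All-resp-↭ p
        drop-pair-shorter : ∀ {zs b l zs′} → zs ↭ b ∷ l ∷ zs′ → length zs′ < length zs
        drop-pair-shorter {zs′ = zs′} p = subst (length zs′ <_) (sym (↭-length p)) (m<n⇒m<1+n (n<1+n _))
        go : ∀ {zs} → All IsStem zs → CyclicChain zs → Acc _<_ (length zs) → ∃[ ps ] ClosureSeq u zs ps
        go stems ch (acc rec) with budLeafView IsBud IsLeaf stems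
        ... | adjacent xs b l ys kb kl
          with ps , cs ← go (drop-pair (adjacent-↭ xs ys) stems) (cyclicChain-close-adjacent kb kl xs ch)
                            (rec (drop-pair-shorter (adjacent-↭ xs ys)))
          = (b , l) ∷ ps , close-mid xs ys b l ps kb kl cs
        ... | wrapped l xs b kb kl
          with ps , cs ← go (drop-pair (wrapped-↭ l xs b) stems) (cyclicChain-close-wrapped kb kl xs ch)
                            (rec (drop-pair-shorter (wrapped-↭ l xs b)))
          = (b , l) ∷ ps , close-wrap l xs b ps kb kl cs
        ... | allBuds []           = [] , done
        ... | allBuds (kb ∷ kbs)   =
          ⊥-elim (ℤ.<-irrefl (sym (label-periodic _)) (chain-buds-rise _ (kb ∷ kbs) ch))
        ... | allLeaves []         = [] , done
        ... | allLeaves (kl ∷ kls) =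
          ⊥-elim (ℤ.<-irrefl (label-periodic _) (chain-leaves-fall _ (kl ∷ kls) ch))

      closure-arcs : ∀ {zs ps} → CyclicChain zs → ClosureSeq u zs ps → ∀ {b l} → (b , l) ∈ ps → Arc b l
      closure-arcs ch (close-mid xs ys b l ps kb kl cs) (here refl)  = inj₁ (cyclicChain-adjacent xs ch)
      closure-arcs ch (close-mid xs ys b l ps kb kl cs) (there bl∈)  =
        closure-arcs (cyclicChain-close-adjacent kb kl xs ch) cs bl∈
      closure-arcs ch (close-wrap l xs b ps kb kl cs)  (here refl)  = inj₂ (cyclicChain-wrapped xs ch)
      closure-arcs ch (close-wrap l xs b ps kb kl cs)  (there bl∈)  =
        closure-arcs (cyclicChain-close-wrapped kb kl xs ch) cs bl∈

      stems-closure : ∃[ ps ] ClosureSeq u (stemsInOrder u) ps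
      stems-closure = closure-exists (All.tabulate (proj₂ ∘ ∈-stems⁻)) stems-cyclicChain

      ClosedPair : ℕ → ℕ → Set
      ClosedPair b l = b < n × l < n × IsBud b × IsLeaf l × Arc b l

      closedPair : ∀ {ps b l} → ClosureSeq u (stemsInOrder u) ps → (b , l) ∈ ps → ClosedPair b l
      closedPair cs bl∈ with closure-⊆ _ cs bl∈ | closure-kinds _ cs bl∈
      ... | b∈ , l∈ | kb , kl =
        proj₁ (∈-stems⁻ b∈) , proj₁ (∈-stems⁻ l∈) , kb , kl , closure-arcs stems-cyclicChain cs bl∈

      closedPair⇒labelMatch : ∀ {b l} → ClosedPair b l → LabelMatch u b l
      closedPair⇒labelMatch {b} {l} (b<n , l<n , kb , kl , arc) =
        b<n , l<n , kb , kl , same-label arc , no-leaf-before arc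
        where
        at-base : ∀ {k} → IsLeaf k → stemLabel u k ≡ stemLabel u b → label k ≡ label (suc b)
        at-base kk eq = trans (sym (stemLabel-leaf kk)) (trans eq (stemLabel-bud kb))
        same-label : Arc b l → stemLabel u l ≡ stemLabel u b
        same-label (inj₁ e)       = trans (stemLabel-leaf kl) (trans (returns e) (sym (stemLabel-bud kb)))
        same-label (inj₂ (_ , e)) =
          trans (stemLabel-leaf kl) (trans (sym (label-periodic l)) (trans (returns e) (sym (stemLabel-bud kb))))
        no-leaf-before : Arc b l →
                         ∀ k → k < n → IsLeaf k → stemLabel u k ≡ stemLabel u b → ¬ CycBetween u b k l
        no-leaf-before (inj₁ e) k _ kk eq (inj₁ (_ , b<k , k<l)) = excursion-no-base-leaf e b<k k<l kk (at-base kk eq)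
        no-leaf-before (inj₁ e) _ _ _ _ (inj₂ (l<b , _))       = <-asym (start≤end e) l<b
        no-leaf-before (inj₂ (l<b , _)) _ _ _ _ (inj₁ (b<l , _)) = <-asym b<l l<b
        no-leaf-before (inj₂ (_ , e)) k k<n kk eq (inj₂ (_ , inj₁ b<k)) =
          excursion-no-base-leaf e b<k (<-≤-trans k<n (m≤m+n n l)) kk (at-base kk eq)
        no-leaf-before (inj₂ (_ , e)) k _ kk eq (inj₂ (_ , inj₂ k<l)) =
          excursion-no-base-leaf e (≤-trans b<n (m≤m+n n k)) (+-monoʳ-< n k<l) (trans (kindAt-periodic k) kk)
                                 (trans (label-periodic k) (at-base kk eq))

      labelMatch⇒closed : ∀ {ps b l} → ClosureSeq u (stemsInOrder u) ps → LabelMatch u b l → (b , l) ∈ ps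
      labelMatch⇒closed {ps} cs lm@(b<n , _ , kb , _) with closure-bud-partner cs (∈-stems⁺ b<n (inj₁ kb)) kb
      ... | l′ , bl′∈ =
        subst (λ x → (_ , x) ∈ ps) (labelMatch-unique (closedPair⇒labelMatch (closedPair cs bl′∈)) lm) bl′∈

      labelsNonneg⇒wellRooted : AllLabelsNonneg u → WellRooted u
      labelsNonneg⇒wellRooted nonneg ps cs b l bl∈ _ between with closedPair cs bl∈ | between
      ... | _ , _ , _ , _ , inj₁ _         | inj₁ (_ , () , _)
      ... | _ , _ , _ , _ , inj₁ e         | inj₂ (l<b , _) = <-asym (start≤end e) l<b
      ... | b<n , _ , kb , _ , inj₂ (_ , e) | _ =
        ℤ.<⇒≱ (ℤ.≤-<-trans (nonneg b b<n) (label-bud-< {b} kb))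
              (subst (label (suc b) ℤ.≤_) label-returns (above e b<n (m≤m+n n l)))

      -- A leaf at level 0 is closed either by an earlier bud, which then sits at level -1,
      -- or by a later bud, in which case the closure passes the root bud.
      wellRooted-leaf-level : WellRooted u → ∀ {i} → (∀ {j} → j < i → j < n → + 0 ℤ.≤ label j) →
                              i < n → IsLeaf i → label i ≢ + 0
      wellRooted-leaf-level wellRooted {i} nonneg-before i<n kl label≡0
        with ps , cs ← stems-closure
        with y , yi∈ ← closure-leaf-partner cs (∈-stems⁺ i<n (inj₂ kl)) kl
        with closedPair cs yi∈
      ... | y<n , _ , ky , _ , inj₁ e =
        ℤ.<⇒≱ (subst (label y ℤ.<_) (trans (sym (returns e)) label≡0) (label-bud-< {y} ky))
              (nonneg-before (start≤end e) y<n)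
      ... | _ , _ , _ , _ , inj₂ (i<y , _) =
        wellRooted ps cs y i yi∈ (λ y≡0 → n≮0 (subst (i <_) y≡0 i<y)) (inj₂ (i<y , inj₂ (leaf-not-root kl)))

      wellRooted⇒labelsNonneg : WellRooted u → AllLabelsNonneg u
      wellRooted⇒labelsNonneg wellRooted = <-rec (λ i → i < n → + 0 ℤ.≤ label i) nonneg-at
        where
        nonneg-at : ∀ i → (∀ {j} → j < i → j < n → + 0 ℤ.≤ label j) → i < n → + 0 ℤ.≤ label i
        nonneg-at zero    _  _     = ℤ.+≤+ z≤n
        nonneg-at (suc i) ih 1+i<n = after (kindAt i) refl
          where
          i<n : i < n
          i<n = <-trans (n<1+n i) 1+i<n
          at-i : + 0 ℤ.≤ label i
          at-i = ih (n<1+n i) i<n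
          after : ∀ k → kindAt i ≡ k → + 0 ℤ.≤ label (suc i)
          after edgeHalf ke = subst (+ 0 ℤ.≤_) (sym (label-edge {i} ke)) at-i
          after bud      kb = ℤ.<⇒≤ (ℤ.≤-<-trans at-i (label-bud-< {i} kb))
          after leaf     kl = subst (+ 0 ℤ.≤_) (sym (label-leaf {i} kl))
            (0≤i-1 at-i (wellRooted-leaf-level wellRooted (λ j<i → ih (<-trans j<i (n<1+n i))) i<n kl))

proposition3p3 : ∀ {n : ℕ} (u : RootedBlossomingMap n) →
    Unicellular u → numLeaves u ≡ numBuds u →
    (∃[ ps ] ClosureSeq u (stemsInOrder u) ps)
    × (∀ ps → ClosureSeq u (stemsInOrder u) ps →
         ∀ b l → (((b , l) ∈ ps) ⇔ LabelMatch u b l))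
    × (WellRooted u ⇔ AllLabelsNonneg u)
proposition3p3 u unicellular balanced =
  stems-closure ,
  (λ ps cs b l → mk⇔ (closedPair⇒labelMatch ∘ closedPair cs) (labelMatch⇒closed cs)) ,
  mk⇔ wellRooted⇒labelsNonneg labelsNonneg⇒wellRooted
  where open Closure u unicellular balanced
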